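{- Let $\mathbf{F}=(F_1,\dots,F_r)$ be a reduced translation-dilation invariant system of polynomials in $\mathbb{Z}[z_1,\dots,z_d]$. Then there exists a function $\sigma:\{1,\dots,r\}\to\{1,\dots,d\}$ such that the determinant $$\Delta(\mathbf{x}_1,\dots,\mathbf{x}_r;\sigma)=\det\big(\partial_{\sigma(i)}F_j(\mathbf{x}_i)\big)_{1\le i,j\le r}$$ is non-zero as a polynomial in the variables $\mathbf{x}_1,\dots,\mathbf{x}_r\in\mathbb{Z}^d$ (i.e. in the $rd$ coordinates $x_{im}$).
   Context: $\partial_m G$ denotes the partial derivative of $G(z_1,\dots,z_d)$ with respect to $z_m$, and $\partial_mF_j(\mathbf{x}_i)$ its evaluation at $\mathbf{x}_i=(x_{i1},\dots,x_{id})$. A system $\mathbf{F}$ is translation-dilation invariant if each $F_j$ is homogeneous of positive degree and there exist $c_{jl}\in\mathbb{Z}[\xi_1,\dots,\xi_d]$ $(0\le l\le j\le r)$ with $c_{jj}=1$ such that $F_j(\mathbf{x}+\boldsymbol{\xi})=c_{j0}(\boldsymbol{\xi})+\sum_{l=1}^j c_{jl}(\boldsymbol{\xi})F_l(\mathbf{x})$ for all $\boldsymbol{\xi}\in\mathbb{Z}^d$; it is reduced if $F_1,\dots,F_r$ are linearly independent. -}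

module Defs where

open import Data.Nat using (ℕ; zero; suc; _≤_; _<_; _∸_; _*_)
open import Data.Integer as ℤ using (ℤ; +_)
open import Data.List using (List; []; _∷_; map; foldr)
open import Data.List.Relation.Unary.All using (All)
open import Data.Fin using (Fin; zero; suc; toℕ; punchIn; combine)
open import Data.Product using (Σ; _×_)
open import Data.Sum using (_⊎_)
open import Data.Unit using (⊤)
open import Function using (_∘_)
open import Relation.Binary.PropositionalEquality using (_≡_)

-- Dense recursive multivariate integer polynomials.
-- Poly n = ℤ[z₀,…,z_{n-1}].  An element of Poly (suc n) is the
-- coefficient list [p₀, p₁, …] of Σ pᵢ z₀ⁱ with pᵢ ∈ ℤ[z₁,…,z_n]
-- (variable  suc k  of Poly (suc n) is variable k of Poly n).
-- Representations are not unique (trailing zeros); equality of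
-- polynomials is  _≈P_  defined via IsZero below.

Poly : ℕ → Set
Poly zero    = ℤ
Poly (suc n) = List (Poly n)

0P : ∀ {n} → Poly n
0P {zero}  = + 0
0P {suc n} = []

κ : ∀ {n} → ℤ → Poly n
κ {zero}  c = c
κ {suc n} c = κ c ∷ []

infixl 6 _⊕_
infixl 7 _⊗_

_⊕_ : ∀ {n} → Poly n → Poly n → Poly n
_⊕_ {zero}  a       b       = a ℤ.+ b
_⊕_ {suc n} []      q       = q
_⊕_ {suc n} (a ∷ p) []      = a ∷ p
_⊕_ {suc n} (a ∷ p) (b ∷ q) = (a ⊕ b) ∷ (p ⊕ q)

scale : ∀ {n} → ℤ → Poly n → Poly n
scale {zero}  c a = c ℤ.* a
scale {suc n} c p = map (scale c) p

_⊗_ : ∀ {n} → Poly n → Poly n → Poly n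
_⊗_ {zero}  a       b = a ℤ.* b
_⊗_ {suc n} []      q = []
_⊗_ {suc n} (a ∷ p) q = map (a ⊗_) q ⊕ (0P ∷ (p ⊗ q))

var : ∀ {n} → Fin n → Poly n
var {suc n} zero    = 0P ∷ κ (+ 1) ∷ []
var {suc n} (suc k) = var k ∷ []

-- substitution z_k ↦ σ k  (with m = 0 this is evaluation at σ ∈ ℤⁿ)
subst : ∀ {n m} → (Fin n → Poly m) → Poly n → Poly m
subst {zero}  σ c = κ c
subst {suc n} σ p = foldr (λ a acc → subst (σ ∘ suc) a ⊕ σ zero ⊗ acc) 0P p

ev : ∀ {n} → (Fin n → ℤ) → Poly n → ℤ
ev ξ p = subst ξ p

derivFrom : ∀ {n} → ℕ → List (Poly n) → List (Poly n)
derivFrom k []      = []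
derivFrom k (a ∷ p) = scale (+ k) a ∷ derivFrom (suc k) p

∂ : ∀ {n} → Fin n → Poly n → Poly n
∂ {suc n} zero    []      = []
∂ {suc n} zero    (a ∷ p) = derivFrom 1 p
∂ {suc n} (suc k) p       = map (∂ k) p

IsZero : ∀ {n} → Poly n → Set
IsZero {zero}  c = c ≡ + 0
IsZero {suc n} p = All IsZero p

infix 4 _≈P_
_≈P_ : ∀ {n} → Poly n → Poly n → Set
p ≈P q = IsZero (p ⊕ scale (ℤ.- (+ 1)) q)

mutual
  Hom : ∀ {n} → ℕ → Poly n → Set
  Hom {zero}  k c = k ≡ 0 ⊎ c ≡ + 0
  Hom {suc n} k p = homFrom k 0 p

  -- homFrom k i [pᵢ, pᵢ₊₁, …]: each coefficient of z₀ʲ is homogeneous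
  -- of degree k - j (or zero, in particular when j > k)
  homFrom : ∀ {n} → ℕ → ℕ → List (Poly n) → Set
  homFrom k i []      = ⊤
  homFrom k i (a ∷ p) = ((i ≤ k × Hom (k ∸ i) a) ⊎ IsZero a) × homFrom k (suc i) p

sumF : ∀ {n m} → (Fin n → Poly m) → Poly m
sumF {zero}  f = 0P
sumF {suc n} f = f zero ⊕ sumF (f ∘ suc)

sgn : ℕ → ℤ
sgn zero    = + 1
sgn (suc k) = ℤ.- sgn k

det : ∀ {n m} → (Fin n → Fin n → Poly m) → Poly m
det {zero}  M = κ (+ 1)
det {suc n} M =
  sumF (λ j → scale (sgn (toℕ j)) (M zero j ⊗ det (λ i k → M (suc i) (punchIn j k))))

-- Systems F = (F₁,…,F_r) in ℤ[z₁,…,z_d], indexed by Fin r (0-based).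

Reduced : ∀ {r d} → (Fin r → Poly d) → Set
Reduced {r} F = (a : Fin r → ℤ) → IsZero (sumF (λ j → scale (a j) (F j))) → (j : Fin r) → a j ≡ + 0

-- translation-dilation invariance.  c j l (l : Fin (suc r)) is c_{j,l}:
-- l = zero is c_{j0}, l = suc l' is the coefficient of F_{l'}.  Terms
-- with l' > j are required to vanish, and c_{jj} = 1.
TDI : ∀ {r d} → (Fin r → Poly d) → Set
TDI {r} {d} F =
  ((j : Fin r) → Σ ℕ λ k → 1 ≤ k × Hom k (F j)) ×
  Σ (Fin r → Fin (suc r) → Poly d) λ c →
    ((j : Fin r) → c j (suc j) ≈P κ (+ 1)) ×
    ((j l : Fin r) → toℕ j < toℕ l → IsZero (c j (suc l))) ×
    ((ξ : Fin d → ℤ) (j : Fin r) →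
       subst (λ m → var m ⊕ κ (ξ m)) (F j)
         ≈P κ (ev ξ (c j zero)) ⊕ sumF (λ l → scale (ev ξ (c j (suc l))) (F l)))

-- Δ(x₁,…,x_r;σ) = det(∂_{σ(i)} F_j (x_i)) ∈ ℤ[x_{im} : i < r, m < d],
-- variable x_{im} being  combine i m : Fin (r * d)
Δ : ∀ {r d} → (Fin r → Poly d) → (Fin r → Fin d) → Poly (r * d)
Δ F σ = det (λ i j → subst (λ m → var (combine i m)) (∂ (σ i) (F j)))

{-# OPTIONS --safe #-}
-- By induction on r, choose σ(2),…,σ(r) and integer points x₂,…,x_r at which
-- the determinant for F₂,…,F_r is non-zero.  Expanding along the row of x₁, the
-- full determinant becomes ∂_m G(x₁), where m = σ(1) and G = Σ_j c_j F_j has the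
-- cofactors c_j as coefficients.  Some ∂_m G is non-zero: otherwise G is
-- constant, and since homogeneity of positive degree makes it vanish at the
-- origin, G = 0, so linear independence forces c₁ = 0, against the choice of
-- x₂,…,x_r.  Throughout, a polynomial is zero exactly when it vanishes at every
-- integer point.
module Submission where

open import Defs
open import Data.Nat as ℕ using (ℕ; zero; suc)
import Data.Nat.Properties as ℕP
open import Data.Integer as ℤ using (ℤ; +_)
open import Data.Integer.Properties
open import Data.Integer.Tactic.RingSolver using (solve-∀)
open import Data.List using (List; []; _∷_; map)
open import Data.List.Relation.Unary.All using (All; []; _∷_; all?; head)
open import Data.Fin using (Fin; zero; suc; toℕ; punchIn; combine; remQuot)
open import Data.Fin.Properties using (remQuot-combine; ¬∀⟶∃¬)
open import Data.Vec.Functional as Vector using ()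
open import Data.Product using (Σ; _×_; _,_; proj₁; proj₂)
open import Data.Sum using (inj₁; inj₂; [_,_]′)
open import Data.Empty using (⊥-elim)
open import Function using (_∘_)
open import Relation.Nullary using (¬_; Dec; yes; no; contradiction)
open import Relation.Binary.PropositionalEquality hiding (subst)
open ≡-Reasoning

private
  variable
    n r d : ℕ

combination : (Fin r → ℤ) → (Fin r → Poly n) → Poly n
combination c F = sumF (λ j → scale (c j) (F j))

sumF-cong : {f g : Fin r → ℤ} → (∀ j → f j ≡ g j) → sumF f ≡ sumF g
sumF-cong {zero}  e = refl
sumF-cong {suc r} e = cong₂ ℤ._+_ (e zero) (sumF-cong (e ∘ suc))

sumF-≡0 : {f : Fin r → ℤ} → (∀ j → f j ≡ + 0) → sumF f ≡ + 0
sumF-≡0 {zero}  e = refl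
sumF-≡0 {suc r} e = cong₂ ℤ._+_ (e zero) (sumF-≡0 (e ∘ suc))

det-cong : {M N : Fin r → Fin r → ℤ} → (∀ i j → M i j ≡ N i j) → det M ≡ det N
det-cong {zero}  e = refl
det-cong {suc r} e = sumF-cong λ j →
  cong (sgn (toℕ j) ℤ.*_) (cong₂ ℤ._*_ (e zero j) (det-cong λ i k → e (suc i) (punchIn j k)))

ev-cong : {ξ ξ' : Fin n → ℤ} → (∀ k → ξ k ≡ ξ' k) → (p : Poly n) → ev ξ p ≡ ev ξ' p
ev-cong {zero}  e p       = refl
ev-cong {suc n} e []      = refl
ev-cong {suc n} e (a ∷ p) = cong₂ ℤ._+_ (ev-cong (e ∘ suc) a) (cong₂ ℤ._*_ (e zero) (ev-cong e p))

ev-0P : (ξ : Fin n → ℤ) → ev ξ (0P {n}) ≡ + 0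
ev-0P {zero}  ξ = refl
ev-0P {suc n} ξ = refl

ev-κ : (ξ : Fin n → ℤ) (c : ℤ) → ev ξ (κ {n} c) ≡ c
ev-κ {zero}  ξ c = refl
ev-κ {suc n} ξ c = trans (cong₂ ℤ._+_ (ev-κ (ξ ∘ suc) c) (*-zeroʳ (ξ zero))) (+-identityʳ c)

ev-⊕ : (ξ : Fin n → ℤ) (p q : Poly n) → ev ξ (p ⊕ q) ≡ ev ξ p ℤ.+ ev ξ q
ev-⊕ {zero}  ξ p       q       = refl
ev-⊕ {suc n} ξ []      q       = sym (+-identityˡ _)
ev-⊕ {suc n} ξ (a ∷ p) []      = sym (+-identityʳ _)
ev-⊕ {suc n} ξ (a ∷ p) (b ∷ q) rewrite ev-⊕ (ξ ∘ suc) a b | ev-⊕ ξ p q =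
  ring-identity (ev (ξ ∘ suc) a) (ev (ξ ∘ suc) b) (ξ zero) (ev ξ p) (ev ξ q)
  where
  ring-identity : ∀ a b x p q → a ℤ.+ b ℤ.+ x ℤ.* (p ℤ.+ q) ≡ a ℤ.+ x ℤ.* p ℤ.+ (b ℤ.+ x ℤ.* q)
  ring-identity = solve-∀

ev-scale : (ξ : Fin n → ℤ) (c : ℤ) (p : Poly n) → ev ξ (scale c p) ≡ c ℤ.* ev ξ p
ev-scale {zero}  ξ c p       = refl
ev-scale {suc n} ξ c []      = sym (*-zeroʳ c)
ev-scale {suc n} ξ c (a ∷ p) rewrite ev-scale (ξ ∘ suc) c a | ev-scale ξ c p =
  ring-identity c (ev (ξ ∘ suc) a) (ξ zero) (ev ξ p)
  where
  ring-identity : ∀ c a x p → c ℤ.* a ℤ.+ x ℤ.* (c ℤ.* p) ≡ c ℤ.* (a ℤ.+ x ℤ.* p)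
  ring-identity = solve-∀

ev-⊗ : (ξ : Fin n → ℤ) (p q : Poly n) → ev ξ (p ⊗ q) ≡ ev ξ p ℤ.* ev ξ q

ev-map-⊗ : (ξ : Fin (suc n) → ℤ) (a : Poly n) (q : Poly (suc n)) →
  ev ξ (map (a ⊗_) q) ≡ ev (ξ ∘ suc) a ℤ.* ev ξ q
ev-map-⊗ ξ a []      = sym (*-zeroʳ (ev (ξ ∘ suc) a))
ev-map-⊗ ξ a (b ∷ q) rewrite ev-⊗ (ξ ∘ suc) a b | ev-map-⊗ ξ a q =
  ring-identity (ev (ξ ∘ suc) a) (ev (ξ ∘ suc) b) (ξ zero) (ev ξ q)
  where
  ring-identity : ∀ a b x q → a ℤ.* b ℤ.+ x ℤ.* (a ℤ.* q) ≡ a ℤ.* (b ℤ.+ x ℤ.* q)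
  ring-identity = solve-∀

ev-⊗ {zero}  ξ p       q = refl
ev-⊗ {suc n} ξ []      q = refl
ev-⊗ {suc n} ξ (a ∷ p) q
  rewrite ev-⊕ ξ (map (a ⊗_) q) (0P ∷ (p ⊗ q)) | ev-map-⊗ ξ a q | ev-0P (ξ ∘ suc) | ev-⊗ ξ p q =
  ring-identity (ev (ξ ∘ suc) a) (ξ zero) (ev ξ p) (ev ξ q)
  where
  ring-identity : ∀ a x p q → a ℤ.* q ℤ.+ (+ 0 ℤ.+ x ℤ.* (p ℤ.* q)) ≡ (a ℤ.+ x ℤ.* p) ℤ.* q
  ring-identity = solve-∀

ev-sumF : (ξ : Fin n → ℤ) (f : Fin r → Poly n) → ev ξ (sumF f) ≡ sumF (λ j → ev ξ (f j))
ev-sumF {r = zero}  ξ f = ev-0P ξ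
ev-sumF {r = suc r} ξ f =
  trans (ev-⊕ ξ (f zero) (sumF (f ∘ suc))) (cong (ℤ._+_ (ev ξ (f zero))) (ev-sumF ξ (f ∘ suc)))

ev-combination : (ξ : Fin n → ℤ) (c : Fin r → ℤ) (F : Fin r → Poly n) →
  ev ξ (combination c F) ≡ sumF (λ j → c j ℤ.* ev ξ (F j))
ev-combination ξ c F = trans (ev-sumF ξ (λ j → scale (c j) (F j))) (sumF-cong λ j → ev-scale ξ (c j) (F j))

ev-var : (ξ : Fin n → ℤ) (k : Fin n) → ev ξ (var k) ≡ ξ k
ev-var {suc n} ξ zero rewrite ev-0P (ξ ∘ suc) | ev-κ (ξ ∘ suc) (+ 1) = ring-identity (ξ zero)
  where
  ring-identity : ∀ x → + 0 ℤ.+ x ℤ.* (+ 1 ℤ.+ x ℤ.* + 0) ≡ x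
  ring-identity = solve-∀
ev-var {suc n} ξ (suc k) rewrite ev-var (ξ ∘ suc) k =
  trans (cong (ℤ._+_ (ξ (suc k))) (*-zeroʳ (ξ zero))) (+-identityʳ _)

ev-subst : ∀ {m} (ξ : Fin m → ℤ) (τ : Fin n → Poly m) (p : Poly n) →
  ev ξ (subst τ p) ≡ ev (λ k → ev ξ (τ k)) p
ev-subst {zero}  ξ τ p       = ev-κ ξ p
ev-subst {suc n} ξ τ []      = ev-0P ξ
ev-subst {suc n} ξ τ (a ∷ p) = begin
  ev ξ (subst (τ ∘ suc) a ⊕ τ zero ⊗ subst τ p)
    ≡⟨ ev-⊕ ξ (subst (τ ∘ suc) a) (τ zero ⊗ subst τ p) ⟩
  ev ξ (subst (τ ∘ suc) a) ℤ.+ ev ξ (τ zero ⊗ subst τ p)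
    ≡⟨ cong₂ ℤ._+_ (ev-subst ξ (τ ∘ suc) a) (ev-⊗ ξ (τ zero) (subst τ p)) ⟩
  ev (τ-at ∘ suc) a ℤ.+ τ-at zero ℤ.* ev ξ (subst τ p)
    ≡⟨ cong (λ v → ev (τ-at ∘ suc) a ℤ.+ τ-at zero ℤ.* v) (ev-subst ξ τ p) ⟩
  ev (τ-at ∘ suc) a ℤ.+ τ-at zero ℤ.* ev τ-at p ∎
  where
  τ-at : Fin (suc n) → ℤ
  τ-at k = ev ξ (τ k)

ev-det : (ξ : Fin n → ℤ) (M : Fin r → Fin r → Poly n) → ev ξ (det M) ≡ det (λ i j → ev ξ (M i j))
ev-det {r = zero}  ξ M = ev-κ ξ (+ 1)
ev-det {r = suc r} ξ M = trans (ev-sumF ξ (λ j → scale (sgn (toℕ j)) (M zero j ⊗ det (minor j)))) (sumF-cong λ j → begin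
  ev ξ (scale (sgn (toℕ j)) (M zero j ⊗ det (minor j)))
    ≡⟨ ev-scale ξ (sgn (toℕ j)) _ ⟩
  sgn (toℕ j) ℤ.* ev ξ (M zero j ⊗ det (minor j))
    ≡⟨ cong (sgn (toℕ j) ℤ.*_) (ev-⊗ ξ (M zero j) (det (minor j))) ⟩
  sgn (toℕ j) ℤ.* (ev ξ (M zero j) ℤ.* ev ξ (det (minor j)))
    ≡⟨ cong (λ v → sgn (toℕ j) ℤ.* (ev ξ (M zero j) ℤ.* v)) (ev-det ξ (minor j)) ⟩
  _ ∎)
  where
  minor : Fin (suc r) → Fin r → Fin r → Poly _
  minor j i k = M (suc i) (punchIn j k)

scale-⊕ : (c : ℤ) (p q : Poly n) → scale c (p ⊕ q) ≡ scale c p ⊕ scale c q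
scale-⊕ {zero}  c p       q       = *-distribˡ-+ c p q
scale-⊕ {suc n} c []      q       = refl
scale-⊕ {suc n} c (a ∷ p) []      = refl
scale-⊕ {suc n} c (a ∷ p) (b ∷ q) = cong₂ _∷_ (scale-⊕ c a b) (scale-⊕ c p q)

scale-comm : (c k : ℤ) (p : Poly n) → scale c (scale k p) ≡ scale k (scale c p)
scale-comm {zero}  c k p       = trans (sym (*-assoc c k p)) (trans (cong (ℤ._* p) (*-comm c k)) (*-assoc k c p))
scale-comm {suc n} c k []      = refl
scale-comm {suc n} c k (a ∷ p) = cong₂ _∷_ (scale-comm c k a) (scale-comm c k p)

derivFrom-⊕ : ∀ k (p q : List (Poly n)) → derivFrom k (p ⊕ q) ≡ derivFrom k p ⊕ derivFrom k q
derivFrom-⊕ k []      q       = refl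
derivFrom-⊕ k (a ∷ p) []      = refl
derivFrom-⊕ k (a ∷ p) (b ∷ q) = cong₂ _∷_ (scale-⊕ (+ k) a b) (derivFrom-⊕ (suc k) p q)

derivFrom-scale : ∀ k c (p : List (Poly n)) → derivFrom k (map (scale c) p) ≡ map (scale c) (derivFrom k p)
derivFrom-scale k c []      = refl
derivFrom-scale k c (a ∷ p) = cong₂ _∷_ (sym (scale-comm c (+ k) a)) (derivFrom-scale (suc k) c p)

⊕-identityʳ : (p : Poly (suc n)) → p ⊕ [] ≡ p
⊕-identityʳ []      = refl
⊕-identityʳ (a ∷ p) = refl

∂-⊕ : (m : Fin n) (p q : Poly n) → ∂ m (p ⊕ q) ≡ ∂ m p ⊕ ∂ m q
∂-⊕ {suc n} zero    []      q       = refl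
∂-⊕ {suc n} zero    (a ∷ p) []      = sym (⊕-identityʳ _)
∂-⊕ {suc n} zero    (a ∷ p) (b ∷ q) = derivFrom-⊕ 1 p q
∂-⊕ {suc n} (suc m) []      q       = refl
∂-⊕ {suc n} (suc m) (a ∷ p) []      = sym (⊕-identityʳ _)
∂-⊕ {suc n} (suc m) (a ∷ p) (b ∷ q) = cong₂ _∷_ (∂-⊕ m a b) (∂-⊕ (suc m) p q)

∂-scale : (m : Fin n) (c : ℤ) (p : Poly n) → ∂ m (scale c p) ≡ scale c (∂ m p)
∂-scale {suc n} zero    c []      = refl
∂-scale {suc n} zero    c (a ∷ p) = derivFrom-scale 1 c p
∂-scale {suc n} (suc m) c []      = refl
∂-scale {suc n} (suc m) c (a ∷ p) = cong₂ _∷_ (∂-scale m c a) (∂-scale (suc m) c p)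

∂-0P : (m : Fin n) → ∂ m (0P {n}) ≡ 0P
∂-0P {suc n} zero    = refl
∂-0P {suc n} (suc m) = refl

∂-combination : (m : Fin n) (c : Fin r → ℤ) (F : Fin r → Poly n) →
  ∂ m (combination c F) ≡ combination c (∂ m ∘ F)
∂-combination {r = zero}  m c F = ∂-0P m
∂-combination {r = suc r} m c F = begin
  ∂ m (scale (c zero) (F zero) ⊕ combination (c ∘ suc) (F ∘ suc))
    ≡⟨ ∂-⊕ m _ _ ⟩
  ∂ m (scale (c zero) (F zero)) ⊕ ∂ m (combination (c ∘ suc) (F ∘ suc))
    ≡⟨ cong₂ _⊕_ (∂-scale m (c zero) (F zero)) (∂-combination m (c ∘ suc) (F ∘ suc)) ⟩
  combination c (∂ m ∘ F) ∎

isZero? : (p : Poly n) → Dec (IsZero p)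
isZero? {zero}  p = p ℤ.≟ + 0
isZero? {suc n} p = all? isZero? p

IsZero⇒ev≡0 : (ξ : Fin n → ℤ) {p : Poly n} → IsZero p → ev ξ p ≡ + 0
IsZero⇒ev≡0 {zero}  ξ z                = z
IsZero⇒ev≡0 {suc n} ξ []               = refl
IsZero⇒ev≡0 {suc n} ξ {a ∷ p} (za ∷ zp) rewrite IsZero⇒ev≡0 (ξ ∘ suc) za | IsZero⇒ev≡0 ξ zp =
  trans (+-identityˡ _) (*-zeroʳ (ξ zero))

m≡[1+m]*n⇒m≡0 : ∀ m n → m ≡ suc m ℕ.* n → m ≡ 0
m≡[1+m]*n⇒m≡0 m zero    e = trans e (ℕP.*-zeroʳ (suc m))
m≡[1+m]*n⇒m≡0 m (suc n) e =
  contradiction (ℕP.≤-trans (ℕP.m≤m*n (suc m) (suc n)) (ℕP.≤-reflexive (sym e))) (ℕP.<-irrefl refl)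

i≢0⇒i+[1+∣i∣]*j≢0 : ∀ i j → i ≢ + 0 → i ℤ.+ + suc ℤ.∣ i ∣ ℤ.* j ≢ + 0
i≢0⇒i+[1+∣i∣]*j≢0 i j i≢0 e = i≢0 (∣i∣≡0⇒i≡0 (m≡[1+m]*n⇒m≡0 ℤ.∣ i ∣ ℤ.∣ j ∣ ∣i∣≡[1+∣i∣]*∣j∣))
  where
  i≡-[1+∣i∣]*j : i ≡ ℤ.- (+ suc ℤ.∣ i ∣ ℤ.* j)
  i≡-[1+∣i∣]*j = begin
    i                                               ≡⟨ ring-identity i _ ⟩
    i ℤ.+ + suc ℤ.∣ i ∣ ℤ.* j ℤ.- + suc ℤ.∣ i ∣ ℤ.* j ≡⟨ cong (ℤ._- (+ suc ℤ.∣ i ∣ ℤ.* j)) e ⟩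
    + 0 ℤ.- + suc ℤ.∣ i ∣ ℤ.* j                      ≡⟨ +-identityˡ _ ⟩
    ℤ.- (+ suc ℤ.∣ i ∣ ℤ.* j)                        ∎
    where
    ring-identity : ∀ a b → a ≡ a ℤ.+ b ℤ.- b
    ring-identity = solve-∀
  ∣i∣≡[1+∣i∣]*∣j∣ : ℤ.∣ i ∣ ≡ suc ℤ.∣ i ∣ ℕ.* ℤ.∣ j ∣
  ∣i∣≡[1+∣i∣]*∣j∣ = trans (cong ℤ.∣_∣ i≡-[1+∣i∣]*j) (trans (∣-i∣≡∣i∣ (+ suc ℤ.∣ i ∣ ℤ.* j)) (abs-* (+ suc ℤ.∣ i ∣) j))

-- The witness for a coefficient list has a positive first coordinate, so that a
-- vanishing first coefficient lets us pass to the tail.  Otherwise the first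
-- coordinate 1 + ∣a(ξ')∣ dominates the constant term a(ξ').
mutual
  ¬IsZero⇒∃ev≢0 : (p : Poly n) → ¬ IsZero p → Σ (Fin n → ℤ) λ ξ → ev ξ p ≢ + 0
  ¬IsZero⇒∃ev≢0 {zero}  p p≢0 = (λ ()) , p≢0
  ¬IsZero⇒∃ev≢0 {suc n} p p≢0 with ¬All⇒∃ev≢0 p p≢0
  ... | ξ , _ , ev≢0 = ξ , ev≢0

  ¬All⇒∃ev≢0 : (p : List (Poly n)) → ¬ All IsZero p →
    Σ (Fin (suc n) → ℤ) λ ξ → (Σ ℕ λ s → ξ zero ≡ + suc s) × ev ξ p ≢ + 0
  ¬All⇒∃ev≢0 []      p≢0 = ⊥-elim (p≢0 [])
  ¬All⇒∃ev≢0 (a ∷ p) p≢0 with isZero? a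
  ... | no a≢0 with ¬IsZero⇒∃ev≢0 a a≢0
  ...   | ξ' , ev≢0 = (+ suc ℤ.∣ ev ξ' a ∣ Vector.∷ ξ') , (_ , refl) , i≢0⇒i+[1+∣i∣]*j≢0 (ev ξ' a) _ ev≢0
  ¬All⇒∃ev≢0 (a ∷ p) p≢0 | yes a≡0 with ¬All⇒∃ev≢0 p (p≢0 ∘ (a≡0 ∷_))
  ... | ξ , (s , ξ₀≡1+s) , ev≢0 = ξ , (s , ξ₀≡1+s) , λ e →
    [ (λ ξ₀≡0 → 1+n≢0 (trans (sym ξ₀≡1+s) ξ₀≡0)) , ev≢0 ]′
      (i*j≡0⇒i≡0∨j≡0 (ξ zero) (begin
        ξ zero ℤ.* ev ξ p                   ≡⟨ +-identityˡ _ ⟨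
        + 0 ℤ.+ ξ zero ℤ.* ev ξ p           ≡⟨ cong (ℤ._+ (ξ zero ℤ.* ev ξ p)) (IsZero⇒ev≡0 (ξ ∘ suc) a≡0) ⟨
        ev (ξ ∘ suc) a ℤ.+ ξ zero ℤ.* ev ξ p ≡⟨ e ⟩
        + 0                                 ∎))
    where
    1+n≢0 : ∀ {m} → + suc m ≢ + 0
    1+n≢0 ()

ev≡0⇒IsZero : (p : Poly n) → (∀ ξ → ev ξ p ≡ + 0) → IsZero p
ev≡0⇒IsZero p ev≡0 with isZero? p
... | yes p≡0 = p≡0
... | no p≢0  = ⊥-elim (proj₂ (¬IsZero⇒∃ev≢0 p p≢0) (ev≡0 _))

IsZero-scale⁻¹ : ∀ {c} → c ≢ + 0 → (p : Poly n) → IsZero (scale c p) → IsZero p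
IsZero-scale⁻¹ {zero}  c≢0 p       z         = [ (λ c≡0 → contradiction c≡0 c≢0) , (λ p≡0 → p≡0) ]′ (i*j≡0⇒i≡0∨j≡0 _ z)
IsZero-scale⁻¹ {suc n} c≢0 []      z         = []
IsZero-scale⁻¹ {suc n} c≢0 (a ∷ p) (za ∷ zp) = IsZero-scale⁻¹ c≢0 a za ∷ IsZero-scale⁻¹ c≢0 p zp

IsZero-derivFrom⁻¹ : ∀ k (p : List (Poly n)) → All IsZero (derivFrom (suc k) p) → All IsZero p
IsZero-derivFrom⁻¹ k []      z         = []
IsZero-derivFrom⁻¹ k (a ∷ p) (za ∷ zp) = IsZero-scale⁻¹ (λ ()) a za ∷ IsZero-derivFrom⁻¹ (suc k) p zp

∂≡0⇒ev-const : (G : Poly n) → (∀ m → IsZero (∂ m G)) → ∀ ξ ξ' → ev ξ G ≡ ev ξ' G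
∂≡0⇒ev-const {zero}  G       ∂G≡0 ξ ξ' = refl
∂≡0⇒ev-const {suc n} []      ∂G≡0 ξ ξ' = refl
∂≡0⇒ev-const {suc n} (a ∷ p) ∂G≡0 ξ ξ' =
  cong₂ ℤ._+_ (∂≡0⇒ev-const a (λ m → head (∂G≡0 (suc m))) (ξ ∘ suc) (ξ' ∘ suc))
              (trans (tail≡0 ξ) (sym (tail≡0 ξ')))
  where
  tail≡0 : (ζ : Fin (suc n) → ℤ) → ζ zero ℤ.* ev ζ p ≡ + 0
  tail≡0 ζ = trans (cong (ζ zero ℤ.*_) (IsZero⇒ev≡0 ζ (IsZero-derivFrom⁻¹ 0 p (∂G≡0 zero)))) (*-zeroʳ (ζ zero))

origin : Fin n → ℤ
origin _ = + 0

Hom⇒ev-origin≡0 : ∀ k → 1 ℕ.≤ k → (p : Poly n) → Hom k p → ev origin p ≡ + 0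
Hom⇒ev-origin≡0 {zero}  k 1≤k p       (inj₁ refl) = contradiction 1≤k (ℕP.<-irrefl refl)
Hom⇒ev-origin≡0 {zero}  k 1≤k p       (inj₂ p≡0) = p≡0
Hom⇒ev-origin≡0 {suc n} k 1≤k []      _                    = refl
Hom⇒ev-origin≡0 {suc n} k 1≤k (a ∷ p) (hom-a , _)          = trans (+-identityʳ _)
  ([ (λ (_ , hom) → Hom⇒ev-origin≡0 k 1≤k a hom) , IsZero⇒ev≡0 origin ]′ hom-a)

Reduced-tail : (F : Fin (suc r) → Poly n) → Reduced F → Reduced (F ∘ suc)
Reduced-tail F reduced a z j = reduced (+ 0 Vector.∷ a) z' (suc j)
  where
  z' : IsZero (combination (+ 0 Vector.∷ a) F)
  z' = ev≡0⇒IsZero _ λ ξ → trans (ev-⊕ ξ _ _) (cong₂ ℤ._+_ (ev-scale ξ (+ 0) (F zero)) (IsZero⇒ev≡0 ξ z))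

Δ-at : (Fin r → Poly d) → (Fin r → Fin d) → (Fin r → Fin d → ℤ) → ℤ
Δ-at F σ X = det (λ i j → ev (X i) (∂ (σ i) (F j)))

cofactor : (F : Fin (suc r) → Poly d) → (Fin r → Fin d) → (Fin r → Fin d → ℤ) → Fin (suc r) → ℤ
cofactor F σ X j = sgn (toℕ j) ℤ.* Δ-at (F ∘ punchIn j) σ X

Δ-at-expand : (F : Fin (suc r) → Poly d) (m : Fin d) (σ : Fin r → Fin d) (x : Fin d → ℤ) (X : Fin r → Fin d → ℤ) →
  Δ-at F (m Vector.∷ σ) (x Vector.∷ X) ≡ ev x (∂ m (combination (cofactor F σ X) F))
Δ-at-expand F m σ x X = sym (begin
  ev x (∂ m (combination (cofactor F σ X) F))
    ≡⟨ cong (ev x) (∂-combination m (cofactor F σ X) F) ⟩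
  ev x (combination (cofactor F σ X) (∂ m ∘ F))
    ≡⟨ ev-combination x (cofactor F σ X) (∂ m ∘ F) ⟩
  sumF (λ j → cofactor F σ X j ℤ.* ev x (∂ m (F j)))
    ≡⟨ sumF-cong (λ j → ring-identity (sgn (toℕ j)) (Δ-at (F ∘ punchIn j) σ X) (ev x (∂ m (F j)))) ⟩
  Δ-at F (m Vector.∷ σ) (x Vector.∷ X) ∎)
  where
  ring-identity : ∀ s D e → s ℤ.* D ℤ.* e ≡ s ℤ.* (e ℤ.* D)
  ring-identity = solve-∀

combination-origin≡0 : (c : Fin r → ℤ) (F : Fin r → Poly n) → (∀ j → ev origin (F j) ≡ + 0) →
  ev origin (combination c F) ≡ + 0
combination-origin≡0 c F F₀≡0 =
  trans (ev-combination origin c F) (sumF-≡0 λ j → trans (cong (c j ℤ.*_) (F₀≡0 j)) (*-zeroʳ (c j)))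

∂≡0⇒IsZero : (G : Poly n) → (∀ m → IsZero (∂ m G)) → ev origin G ≡ + 0 → IsZero G
∂≡0⇒IsZero G ∂G≡0 G₀≡0 = ev≡0⇒IsZero G λ ξ → trans (∂≡0⇒ev-const G ∂G≡0 ξ origin) G₀≡0

-- The coefficient of F zero in this combination is Δ-at (F ∘ suc) σ X, since sgn 0 = 1.
combination-cofactor-nonconstant : (F : Fin (suc r) → Poly d) → Reduced F →
  (∀ j → ev origin (F j) ≡ + 0) → (σ : Fin r → Fin d) (X : Fin r → Fin d → ℤ) →
  Δ-at (F ∘ suc) σ X ≢ + 0 → ¬ (∀ m → IsZero (∂ m (combination (cofactor F σ X) F)))
combination-cofactor-nonconstant F reduced F₀≡0 σ X Δ≢0 ∂G≡0 =
  Δ≢0 (trans (sym (*-identityˡ _)) (reduced (cofactor F σ X) G≡0 zero))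
  where
  G≡0 : IsZero (combination (cofactor F σ X) F)
  G≡0 = ∂≡0⇒IsZero _ ∂G≡0 (combination-origin≡0 (cofactor F σ X) F F₀≡0)

Reduced⇒∃Δ-at≢0 : (F : Fin r → Poly d) → Reduced F → (∀ j → ev origin (F j) ≡ + 0) →
  Σ (Fin r → Fin d) λ σ → Σ (Fin r → Fin d → ℤ) λ X → Δ-at F σ X ≢ + 0
Reduced⇒∃Δ-at≢0 {zero}  F reduced F₀≡0 = (λ ()) , (λ ()) , λ ()
Reduced⇒∃Δ-at≢0 {suc r} F reduced F₀≡0 =
  let σ , X , Δ≢0 = Reduced⇒∃Δ-at≢0 (F ∘ suc) (Reduced-tail F reduced) (F₀≡0 ∘ suc)
      G           = combination (cofactor F σ X) F
      m , ∂mG≢0   = ¬∀⟶∃¬ _ _ (λ m → isZero? (∂ m G))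
                      (combination-cofactor-nonconstant F reduced F₀≡0 σ X Δ≢0)
      x , ∂mG[x]≢0 = ¬IsZero⇒∃ev≢0 (∂ m G) ∂mG≢0
  in (m Vector.∷ σ) , (x Vector.∷ X) , ∂mG[x]≢0 ∘ trans (sym (Δ-at-expand F m σ x X))

flatten : (Fin r → Fin d → ℤ) → Fin (r ℕ.* d) → ℤ
flatten {r} {d} X k = X (proj₁ (remQuot {r} d k)) (proj₂ (remQuot {r} d k))

ev-Δ : (F : Fin r → Poly d) (σ : Fin r → Fin d) (X : Fin r → Fin d → ℤ) →
  ev (flatten X) (Δ F σ) ≡ Δ-at F σ X
ev-Δ {r} {d} F σ X =
  trans (ev-det (flatten X) (λ i j → subst (λ m → var (combine i m)) (∂ (σ i) (F j)))) (det-cong λ i j →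
    trans (ev-subst (flatten X) _ (∂ (σ i) (F j))) (ev-cong (flatten-combine i) (∂ (σ i) (F j))))
  where
  flatten-combine : ∀ i m → ev (flatten X) (var (combine i m)) ≡ X i m
  flatten-combine i m = trans (ev-var (flatten X) (combine i m))
    (cong (λ (i′ , m′) → X i′ m′) (remQuot-combine {r} {d} i m))

lemma4p1 : {r d : ℕ} (F : Fin r → Poly d) → Reduced F → TDI F →
    Σ (Fin r → Fin d) (λ σ → ¬ IsZero (Δ F σ))
lemma4p1 F reduced (homogeneous , _) =
  let σ , X , Δ≢0 = Reduced⇒∃Δ-at≢0 F reduced F₀≡0
  in σ , λ Δ≡0 → Δ≢0 (trans (sym (ev-Δ F σ X)) (IsZero⇒ev≡0 (flatten X) Δ≡0))
  where
  F₀≡0 : ∀ j → ev origin (F j) ≡ + 0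
  F₀≡0 j = let k , 1≤k , hom = homogeneous j in Hom⇒ev-origin≡0 k 1≤k (F j) hom
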